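{- A rooted labeled forest that avoids the pattern $123$ avoids the pattern $2413$ if and only if it is a $P_1$-forest.
   Context: Rooted labeled forest: an unordered forest whose components have distinguished roots and whose vertices carry distinct integer labels $L(v)$. An instance of a pattern $\pi$ of length $k$ (a permutation of $[k]$) is a sequence $v_1,\dots,v_k$ of vertices with $v_i$ a strict ancestor of $v_{i+1}$ and $L(v_1),\dots,L(v_k)$ in the same relative order as $\pi$; avoiding means having no instance. Ancestors of $v$ include $v$ itself. A vertex $v$ is a top-down minimum (TDM) if $L(u)\ge L(v)$ for all ancestors $u$ of $v$; otherwise it is non-TDM. A non-TDM vertex $v$ is special if the path from the root of its component to $v$ contains vertices $v_1,v_2,v_3,v_4$ in that order (not necessarily consecutive) with $v_1,v_3$ TDM and $v_2,v_4$ non-TDM. The ceiling of a special vertex $v$ is its lowest (deepest) ancestor $u$ such that the path from $u$ to $v$ contains vertices $v_1,v_2,v_3,v_4$ in that order with $v_1,v_3$ TDM and $v_2,v_4$ non-TDM. A $P_1$-forest is a forest in which every special vertex $v$ with ceiling $u$ satisfies $L(u)>L(v)$. -}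

module Defs where

open import Data.Nat as ℕ using (ℕ)
open import Data.Integer as ℤ using (ℤ)
open import Data.Fin as Fin using (Fin)
open import Data.Fin.Base using (cast)
open import Data.List using (List; []; _∷_; _++_; length; lookup; concatMap)
open import Data.List.Membership.Propositional using (_∈_)
open import Data.List.Relation.Unary.Unique.Propositional using (Unique)
open import Data.List.Relation.Binary.Sublist.Propositional using (_⊆_)
open import Data.Product using (Σ; ∃; _×_; _,_)
open import Relation.Binary.PropositionalEquality using (_≡_)
open import Relation.Nullary using (¬_)
open import Function.Bundles using (_⇔_)

-- Rooted labeled trees (children in a list; order of children is irrelevant
-- to every notion below) and forests (lists of rooted trees).
data Tree : Set where
  node : ℤ → List Tree → Tree

Forest : Set
Forest = List Tree

mutual
  labelsT : Tree → List ℤ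
  labelsT (node x ts) = x ∷ labelsF ts

  labelsF : Forest → List ℤ
  labelsF [] = []
  labelsF (t ∷ ts) = labelsT t ++ labelsF ts

DistinctLabels : Forest → Set
DistinctLabels F = Unique (labelsF F)

-- PathT t p : p is the list of labels on the path from the root of t
-- down to some vertex of t (root first, that vertex last).
data PathT : Tree → List ℤ → Set where
  here  : ∀ {x ts} → PathT (node x ts) (x ∷ [])
  there : ∀ {x ts t p} → t ∈ ts → PathT t p → PathT (node x ts) (x ∷ p)

PathF : Forest → List ℤ → Set
PathF F p = Σ Tree λ t → t ∈ F × PathT t p

OrderIso : List ℤ → List ℕ → Set
OrderIso s π = Σ (length s ≡ length π) λ eq →
  ∀ i j → (lookup s i ℤ.< lookup s j) ⇔ (lookup π (cast eq i) ℕ.< lookup π (cast eq j))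

-- An instance of π: labels of a chain v₁,…,v_k with vᵢ a strict ancestor of
-- vᵢ₊₁, i.e. a sublist of a root-to-vertex path, order-isomorphic to π.
Contains : Forest → List ℕ → Set
Contains F π = Σ (List ℤ) λ p → Σ (List ℤ) λ s → PathF F p × s ⊆ p × OrderIso s π

Avoids : Forest → List ℕ → Set
Avoids F π = ¬ Contains F π

pat123 : List ℕ
pat123 = 1 ∷ 2 ∷ 3 ∷ []

pat2413 : List ℕ
pat2413 = 2 ∷ 4 ∷ 1 ∷ 3 ∷ []

-- Vertices are addressed by a root-to-vertex path p and a position in it;
-- the ancestors of the vertex at position i are the positions j ≤ i.

TDM : (p : List ℤ) → Fin (length p) → Set
TDM p i = ∀ j → j Fin.≤ i → lookup p i ℤ.≤ lookup p j

Alt4 : (p : List ℤ) → (a b c d v : Fin (length p)) → Set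
Alt4 p a b c d v = a Fin.< b × b Fin.< c × c Fin.< d × d Fin.≤ v ×
  TDM p a × ¬ TDM p b × TDM p c × ¬ TDM p d

Window : (p : List ℤ) → (u v : Fin (length p)) → Set
Window p u v = u Fin.≤ v × Σ (Fin (length p)) λ a → Σ (Fin (length p)) λ b →
  Σ (Fin (length p)) λ c → Σ (Fin (length p)) λ d → u Fin.≤ a × Alt4 p a b c d v

Special : (p : List ℤ) → Fin (length p) → Set
Special p v = ¬ TDM p v × Σ (Fin (length p)) λ a → Σ (Fin (length p)) λ b →
  Σ (Fin (length p)) λ c → Σ (Fin (length p)) λ d → Alt4 p a b c d v

IsCeiling : (p : List ℤ) → (v u : Fin (length p)) → Set
IsCeiling p v u = Window p u v × (∀ u′ → Window p u′ v → u′ Fin.≤ u)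

P1Forest : Forest → Set
P1Forest F = ∀ p → PathF F p → ∀ v u → Special p v → IsCeiling p v u →
  lookup p v ℤ.< lookup p u

-- Everything happens on a single root-to-vertex path, whose labels are distinct and avoid 123.
-- A non-TDM vertex has an ancestor with a smaller label, so, as 123 is avoided, it is larger than
-- all its descendants.
--
-- If a special vertex v had L(u) < L(v) for its ceiling u, the alternation u < b < c ≤ v in the
-- window of u (u, c TDM, b non-TDM) would give L(c) < L(u) < L(v) < L(b): an occurrence
-- u, b, c, v of 2413.
--
-- Conversely, in an occurrence i < j < k < l of 2413, j and l are non-TDM, k is TDM because it
-- has the larger descendant l, and a TDM ancestor m of i with L(m) ≤ L(i) starts the alternation
-- m, j, k, l.  So l is special, and its ceiling u ≥ m is TDM, whence L(u) ≤ L(m) ≤ L(i) < L(l).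
module Submission where

open import Defs
open import Data.Nat as ℕ using (ℕ; suc; z≤n; s≤s)
import Data.Nat.Properties as ℕP
open import Data.Integer as ℤ using (ℤ)
import Data.Integer.Properties as ℤP
open import Data.Fin as Fin using (Fin; zero; suc)
import Data.Fin.Properties as FinP
open import Data.Fin.Induction using (<-wellFounded; >-wellFounded)
open import Data.List using (List; []; _∷_; length; lookup; map)
open import Data.List.Properties using (length-map)
open import Data.List.Membership.Propositional using (_∈_)
open import Data.List.Membership.Propositional.Properties using (∈-lookup)
open import Data.List.Relation.Unary.Any using (here; there)
import Data.List.Relation.Unary.All as All
open import Data.List.Relation.Unary.All.Properties using (anti-mono)
open import Data.List.Relation.Unary.AllPairs using (AllPairs; []; _∷_)
open import Data.List.Relation.Unary.Unique.Propositional using (Unique)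
open import Data.List.Relation.Binary.Sublist.Propositional
  using (_⊆_; []; _∷_; _∷ʳ_; minimum; ⊆-refl; ⊆-trans) renaming (lookup to ⊆-lookup)
open import Data.List.Relation.Binary.Sublist.Propositional.Properties using (++⁺ˡ; ++⁺ʳ)
open import Data.Product using (∃-syntax; _×_; _,_)
open import Data.Empty using (⊥-elim)
open import Function.Base using (_∘_; const)
open import Function.Bundles using (_⇔_; mk⇔; Equivalence)
open import Induction.WellFounded using (Acc; acc)
open import Relation.Binary.Core using (_Preserves_⟶_)
open import Relation.Binary.Definitions using (tri<; tri≈; tri>)
open import Relation.Binary.PropositionalEquality using (_≡_; _≢_; refl; sym; cong; subst₂)
open import Relation.Nullary using (¬_; Dec; yes; no)
open import Relation.Nullary.Decidable using (_×-dec_; _→-dec_; ¬?)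
open import Relation.Unary using (Decidable)

AllPairs-anti-mono : ∀ {A : Set} {R : A → A → Set} {xs ys : List A} →
  xs ⊆ ys → AllPairs R ys → AllPairs R xs
AllPairs-anti-mono [] [] = []
AllPairs-anti-mono (_ ∷ʳ xs⊆ys) (_ ∷ rys) = AllPairs-anti-mono xs⊆ys rys
AllPairs-anti-mono (refl ∷ xs⊆ys) (rx ∷ rys) =
  anti-mono (⊆-lookup xs⊆ys) rx ∷ AllPairs-anti-mono xs⊆ys rys

Unique⇒lookup-injective : ∀ {A : Set} {xs : List A} → Unique xs →
  ∀ i j → lookup xs i ≡ lookup xs j → i ≡ j
Unique⇒lookup-injective (_ ∷ _) zero zero _ = refl
Unique⇒lookup-injective (x∉xs ∷ _) zero (suc j) eq = ⊥-elim (All.lookup x∉xs (∈-lookup j) eq)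
Unique⇒lookup-injective (x∉xs ∷ _) (suc i) zero eq = ⊥-elim (All.lookup x∉xs (∈-lookup i) (sym eq))
Unique⇒lookup-injective (_ ∷ unique) (suc i) (suc j) eq =
  cong suc (Unique⇒lookup-injective unique i j eq)

labelsT⊆labelsF : ∀ {t ts} → t ∈ ts → labelsT t ⊆ labelsF ts
labelsT⊆labelsF {ts = t ∷ ts} (here refl) = ++⁺ʳ (labelsF ts) ⊆-refl
labelsT⊆labelsF {ts = t ∷ ts} (there t∈ts) = ++⁺ˡ (labelsT t) (labelsT⊆labelsF t∈ts)

PathT⇒⊆labelsT : ∀ {t p} → PathT t p → p ⊆ labelsT t
PathT⇒⊆labelsT here = refl ∷ minimum _
PathT⇒⊆labelsT (there t∈ts path) = refl ∷ ⊆-trans (PathT⇒⊆labelsT path) (labelsT⊆labelsF t∈ts)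

PathF⇒Unique : ∀ {F p} → DistinctLabels F → PathF F p → Unique p
PathF⇒Unique distinct (t , t∈F , path) =
  AllPairs-anti-mono (⊆-trans (PathT⇒⊆labelsT path) (labelsT⊆labelsF t∈F)) distinct

module _ {A : Set} where

  lookup-⊆₁ : ∀ (xs : List A) i → lookup xs i ∷ [] ⊆ xs
  lookup-⊆₁ (x ∷ xs) zero = refl ∷ minimum xs
  lookup-⊆₁ (x ∷ xs) (suc i) = x ∷ʳ lookup-⊆₁ xs i

  lookup-⊆₂ : ∀ (xs : List A) {i j} → i Fin.< j → lookup xs i ∷ lookup xs j ∷ [] ⊆ xs
  lookup-⊆₂ (x ∷ xs) {zero} {suc j} _ = refl ∷ lookup-⊆₁ xs j
  lookup-⊆₂ (x ∷ xs) {suc i} {suc j} (s≤s i<j) = x ∷ʳ lookup-⊆₂ xs i<j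

  lookup-⊆₃ : ∀ (xs : List A) {i j k} → i Fin.< j → j Fin.< k →
    lookup xs i ∷ lookup xs j ∷ lookup xs k ∷ [] ⊆ xs
  lookup-⊆₃ (x ∷ xs) {zero} {suc j} {suc k} _ (s≤s j<k) = refl ∷ lookup-⊆₂ xs j<k
  lookup-⊆₃ (x ∷ xs) {suc i} {suc j} {suc k} (s≤s i<j) (s≤s j<k) = x ∷ʳ lookup-⊆₃ xs i<j j<k

  lookup-⊆₄ : ∀ (xs : List A) {i j k l} → i Fin.< j → j Fin.< k → k Fin.< l →
    lookup xs i ∷ lookup xs j ∷ lookup xs k ∷ lookup xs l ∷ [] ⊆ xs
  lookup-⊆₄ (x ∷ xs) {zero} {suc j} {suc k} {suc l} _ (s≤s j<k) (s≤s k<l) =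
    refl ∷ lookup-⊆₃ xs j<k k<l
  lookup-⊆₄ (x ∷ xs) {suc i} {suc j} {suc k} {suc l} (s≤s i<j) (s≤s j<k) (s≤s k<l) =
    x ∷ʳ lookup-⊆₄ xs i<j j<k k<l

  ⊆⇒lookup₁ : ∀ {a} {xs : List A} → a ∷ [] ⊆ xs → ∃[ i ] lookup xs i ≡ a
  ⊆⇒lookup₁ (_ ∷ʳ sub) with i , eq ← ⊆⇒lookup₁ sub = suc i , eq
  ⊆⇒lookup₁ (refl ∷ _) = zero , refl

  ⊆⇒lookup₂ : ∀ {a b} {xs : List A} → a ∷ b ∷ [] ⊆ xs →
    ∃[ i ] ∃[ j ] i Fin.< j × lookup xs i ≡ a × lookup xs j ≡ b
  ⊆⇒lookup₂ (_ ∷ʳ sub) with i , j , i<j , eqs ← ⊆⇒lookup₂ sub = suc i , suc j , s≤s i<j , eqs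
  ⊆⇒lookup₂ (refl ∷ sub) with j , eq ← ⊆⇒lookup₁ sub = zero , suc j , s≤s z≤n , refl , eq

  ⊆⇒lookup₃ : ∀ {a b c} {xs : List A} → a ∷ b ∷ c ∷ [] ⊆ xs →
    ∃[ i ] ∃[ j ] ∃[ k ] i Fin.< j × j Fin.< k ×
      lookup xs i ≡ a × lookup xs j ≡ b × lookup xs k ≡ c
  ⊆⇒lookup₃ (_ ∷ʳ sub) with i , j , k , i<j , j<k , eqs ← ⊆⇒lookup₃ sub =
    suc i , suc j , suc k , s≤s i<j , s≤s j<k , eqs
  ⊆⇒lookup₃ (refl ∷ sub) with j , k , j<k , eqs ← ⊆⇒lookup₂ sub =
    zero , suc j , suc k , s≤s z≤n , s≤s j<k , refl , eqs

  ⊆⇒lookup₄ : ∀ {a b c d} {xs : List A} → a ∷ b ∷ c ∷ d ∷ [] ⊆ xs →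
    ∃[ i ] ∃[ j ] ∃[ k ] ∃[ l ] i Fin.< j × j Fin.< k × k Fin.< l ×
      lookup xs i ≡ a × lookup xs j ≡ b × lookup xs k ≡ c × lookup xs l ≡ d
  ⊆⇒lookup₄ (_ ∷ʳ sub) with i , j , k , l , i<j , j<k , k<l , eqs ← ⊆⇒lookup₄ sub =
    suc i , suc j , suc k , suc l , s≤s i<j , s≤s j<k , s≤s k<l , eqs
  ⊆⇒lookup₄ (refl ∷ sub) with j , k , l , j<k , k<l , eqs ← ⊆⇒lookup₃ sub =
    zero , suc j , suc k , suc l , s≤s z≤n , s≤s j<k , s≤s k<l , refl , eqs

lookup-map : ∀ {A B : Set} (f : A → B) (xs : List A) (eq : length (map f xs) ≡ length xs) i →
  lookup (map f xs) i ≡ f (lookup xs (Fin.cast eq i))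
lookup-map f (x ∷ xs) eq zero = refl
lookup-map f (x ∷ xs) eq (suc i) = lookup-map f xs (cong ℕ.pred eq) i

strictMono⇒<⇔< : ∀ {f : ℕ → ℤ} → f Preserves ℕ._<_ ⟶ ℤ._<_ →
  ∀ {m n} → (f m ℤ.< f n) ⇔ (m ℕ.< n)
strictMono⇒<⇔< {f} mono {m} {n} = mk⇔ reflects mono
  where
  reflects : f m ℤ.< f n → m ℕ.< n
  reflects fm<fn with ℕP.<-cmp m n
  ... | tri< m<n _ _ = m<n
  ... | tri≈ _ refl _ = ⊥-elim (ℤP.<-irrefl refl fm<fn)
  ... | tri> _ _ n<m = ⊥-elim (ℤP.<-asym fm<fn (mono n<m))

strictMono⇒OrderIso : ∀ {f : ℕ → ℤ} → f Preserves ℕ._<_ ⟶ ℤ._<_ → ∀ π → OrderIso (map f π) π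
strictMono⇒OrderIso {f} mono π = eq , λ i j →
  subst₂ (λ x y → (x ℤ.< y) ⇔ (lookup π (Fin.cast eq i) ℕ.< lookup π (Fin.cast eq j)))
    (sym (lookup-map f π eq i)) (sym (lookup-map f π eq j)) (strictMono⇒<⇔< mono)
  where
  eq : length (map f π) ≡ length π
  eq = length-map f π

sucMono⇒strictMono : ∀ (f : ℕ → ℤ) → (∀ n → f n ℤ.< f (suc n)) → f Preserves ℕ._<_ ⟶ ℤ._<_
sucMono⇒strictMono f step = increasing ∘ ℕP.<⇒<′
  where
  increasing : ∀ {m n} → m ℕ.<′ n → f m ℤ.< f n
  increasing ℕ.<′-base = step _
  increasing (ℕ.<′-step m<′n) = ℤP.<-trans (increasing m<′n) (step _)

pred[i]<i : ∀ i → ℤ.pred i ℤ.< i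
pred[i]<i i = ℤP.i≤pred[j]⇒i<j ℤP.≤-refl

i<suc[i] : ∀ i → i ℤ.< ℤ.suc i
i<suc[i] i = ℤP.suc[i]≤j⇒i<j ℤP.≤-refl

-- f sends the value r of the pattern to the entry of rank r; the padding below 1 and above the
-- pattern length only serves to make f strictly monotone on all of ℕ.
OrderIso-123 : ∀ {x y z : ℤ} → x ℤ.< y → y ℤ.< z → OrderIso (x ∷ y ∷ z ∷ []) pat123
OrderIso-123 {x} {y} {z} x<y y<z = strictMono⇒OrderIso (sucMono⇒strictMono f step) pat123
  where
  f : ℕ → ℤ
  f 0 = ℤ.pred x
  f 1 = x
  f 2 = y
  f 3 = z
  f (suc n@(suc (suc (suc _)))) = ℤ.suc (f n)
  step : ∀ n → f n ℤ.< f (suc n)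
  step 0 = pred[i]<i x
  step 1 = x<y
  step 2 = y<z
  step n@(suc (suc (suc _))) = i<suc[i] (f n)

OrderIso-2413 : ∀ {w x y z : ℤ} → y ℤ.< w → w ℤ.< z → z ℤ.< x →
  OrderIso (w ∷ x ∷ y ∷ z ∷ []) pat2413
OrderIso-2413 {w} {x} {y} {z} y<w w<z z<x =
  strictMono⇒OrderIso (sucMono⇒strictMono f step) pat2413
  where
  f : ℕ → ℤ
  f 0 = ℤ.pred y
  f 1 = y
  f 2 = w
  f 3 = z
  f 4 = x
  f (suc n@(suc (suc (suc (suc _))))) = ℤ.suc (f n)
  step : ∀ n → f n ℤ.< f (suc n)
  step 0 = pred[i]<i y
  step 1 = y<w
  step 2 = w<z
  step 3 = z<x
  step n@(suc (suc (suc (suc _)))) = i<suc[i] (f n)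

OrderIso-2413⁻ : ∀ {w x y z : ℤ} → OrderIso (w ∷ x ∷ y ∷ z ∷ []) pat2413 →
  y ℤ.< w × w ℤ.< z × z ℤ.< x
OrderIso-2413⁻ (_ , iso) =
  Equivalence.from (iso (suc (suc zero)) zero) (ℕP.n<1+n 1) ,
  Equivalence.from (iso zero (suc (suc (suc zero)))) (ℕP.n<1+n 2) ,
  Equivalence.from (iso (suc (suc (suc zero))) (suc zero)) (ℕP.n<1+n 3)

∃-greatest : ∀ {n} {P : Fin n → Set} → Decidable P → ∀ {x} → P x →
  ∃[ y ] x Fin.≤ y × P y × (∀ z → P z → z Fin.≤ y)
∃-greatest {P = P} P? {x} px = search (>-wellFounded x) ℕP.≤-refl px
  where
  search : ∀ {y} → Acc Fin._>_ y → x Fin.≤ y → P y → ∃[ y ] x Fin.≤ y × P y × (∀ z → P z → z Fin.≤ y)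
  search {y} (acc rec) x≤y py with FinP.any? (λ z → (y FinP.<? z) ×-dec P? z)
  ... | yes (z , y<z , pz) = search (rec y<z) (ℕP.≤-trans x≤y (ℕP.<⇒≤ y<z)) pz
  ... | no ∄ = y , x≤y , py , λ z pz → ℕP.≮⇒≥ (λ y<z → ∄ (z , y<z , pz))

module _ (p : List ℤ) where

  dominated-by? : ∀ i j → Dec (j Fin.≤ i → lookup p i ℤ.≤ lookup p j)
  dominated-by? i j = (j FinP.≤? i) →-dec (lookup p i ℤP.≤? lookup p j)

  TDM? : ∀ i → Dec (TDM p i)
  TDM? i = FinP.all? (dominated-by? i)

  smaller-ancestor⇒¬TDM : ∀ {i j} → j Fin.≤ i → lookup p j ℤ.< lookup p i → ¬ TDM p i
  smaller-ancestor⇒¬TDM j≤i Lj<Li tdm = ℤP.<-irrefl refl (ℤP.≤-<-trans (tdm _ j≤i) Lj<Li)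

  ¬TDM⇒smaller-ancestor : ∀ {i} → ¬ TDM p i → ∃[ j ] j Fin.< i × lookup p j ℤ.< lookup p i
  ¬TDM⇒smaller-ancestor {i} ¬tdm with j , ¬dominated ← FinP.¬∀⟶∃¬ _ _ (dominated-by? i) ¬tdm
    with j FinP.≤? i
  ... | no j≰i = ⊥-elim (¬dominated (⊥-elim ∘ j≰i))
  ... | yes j≤i = j , FinP.≤∧≢⇒< j≤i j≢i , Lj<Li
    where
    Lj<Li : lookup p j ℤ.< lookup p i
    Lj<Li = ℤP.≰⇒> (¬dominated ∘ const)
    j≢i : j ≢ i
    j≢i refl = ℤP.<-irrefl refl Lj<Li

  TDM-ancestor : ∀ i → ∃[ m ] m Fin.≤ i × TDM p m × lookup p m ℤ.≤ lookup p i
  TDM-ancestor i = descend (<-wellFounded i)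
    where
    descend : ∀ {i} → Acc Fin._<_ i → ∃[ m ] m Fin.≤ i × TDM p m × lookup p m ℤ.≤ lookup p i
    descend {i} (acc rec) with TDM? i
    ... | yes tdm = i , ℕP.≤-refl , tdm , ℤP.≤-refl
    ... | no ¬tdm
      with j , j<i , Lj<Li ← ¬TDM⇒smaller-ancestor ¬tdm
      with m , m≤j , tdm , Lm≤Lj ← descend (rec j<i)
      = m , ℕP.≤-trans m≤j (ℕP.<⇒≤ j<i) , tdm , ℤP.≤-trans Lm≤Lj (ℤP.<⇒≤ Lj<Li)

  Alt4? : ∀ a b c d v → Dec (Alt4 p a b c d v)
  Alt4? a b c d v = (a FinP.<? b) ×-dec (b FinP.<? c) ×-dec (c FinP.<? d) ×-dec (d FinP.≤? v)
    ×-dec TDM? a ×-dec ¬? (TDM? b) ×-dec TDM? c ×-dec ¬? (TDM? d)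

  Window? : ∀ u v → Dec (Window p u v)
  Window? u v = (u FinP.≤? v) ×-dec FinP.any? λ a → FinP.any? λ b → FinP.any? λ c →
    FinP.any? λ d → (u FinP.≤? a) ×-dec Alt4? a b c d v

  Alt4⇒≤ : ∀ {a b c d v} → Alt4 p a b c d v → a Fin.≤ v
  Alt4⇒≤ (a<b , b<c , c<d , d≤v , _) =
    ℕP.<⇒≤ (ℕP.<-trans a<b (ℕP.<-trans b<c (ℕP.<-≤-trans c<d d≤v)))

  Alt4⇒Special : ∀ {a b c v} → Alt4 p a b c v v → Special p v
  Alt4⇒Special alt@(_ , _ , _ , _ , _ , _ , _ , ¬tdm-v) = ¬tdm-v , _ , _ , _ , _ , alt

  Alt4⇒Window : ∀ {a b c d v} → Alt4 p a b c d v → Window p a v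
  Alt4⇒Window alt = Alt4⇒≤ alt , _ , _ , _ , _ , ℕP.≤-refl , alt

  Window⇒∃-ceiling : ∀ {a v} → Window p a v → ∃[ u ] a Fin.≤ u × IsCeiling p v u
  Window⇒∃-ceiling window = ∃-greatest (λ u → Window? u _) window

  -- The alternation a, b, c, d in the window of the ceiling u starts at u, since a itself starts
  -- a window and so a ≤ u.
  ceiling⇒Alt4 : ∀ {u v} → IsCeiling p v u → ∃[ b ] ∃[ c ] ∃[ d ] Alt4 p u b c d v
  ceiling⇒Alt4 ((_ , a , b , c , d , u≤a , alt) , greatest)
    with refl ← FinP.≤-antisym u≤a (greatest a (Alt4⇒Window alt)) = b , c , d , alt

Occurs123 : List ℤ → Set
Occurs123 p = ∃[ i ] ∃[ j ] ∃[ k ] i Fin.< j × j Fin.< k ×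
  lookup p i ℤ.< lookup p j × lookup p j ℤ.< lookup p k

Occurs2413 : List ℤ → Set
Occurs2413 p = ∃[ i ] ∃[ j ] ∃[ k ] ∃[ l ] i Fin.< j × j Fin.< k × k Fin.< l ×
  lookup p k ℤ.< lookup p i × lookup p i ℤ.< lookup p l × lookup p l ℤ.< lookup p j

P1Path : List ℤ → Set
P1Path p = ∀ v u → Special p v → IsCeiling p v u → lookup p v ℤ.< lookup p u

module _ {p : List ℤ} (unique : Unique p) (¬123 : ¬ Occurs123 p) where

  distinct-≤⇒< : ∀ {i j} → i ≢ j → lookup p i ℤ.≤ lookup p j → lookup p i ℤ.< lookup p j
  distinct-≤⇒< i≢j Li≤Lj = ℤP.≤∧≢⇒< Li≤Lj (i≢j ∘ Unique⇒lookup-injective unique _ _)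

  ¬TDM⇒>-descendant : ∀ {i j} → ¬ TDM p i → i Fin.< j → lookup p j ℤ.< lookup p i
  ¬TDM⇒>-descendant {i} {j} ¬tdm i<j with h , h<i , Lh<Li ← ¬TDM⇒smaller-ancestor p ¬tdm =
    distinct-≤⇒< (FinP.<⇒≢ i<j ∘ sym) (ℤP.≮⇒≥ λ Li<Lj → ¬123 (h , i , j , h<i , i<j , Lh<Li , Li<Lj))

  Alt4⇒end<start : ¬ Occurs2413 p → ∀ {u b c d v} → Alt4 p u b c d v →
    lookup p v ℤ.< lookup p u
  Alt4⇒end<start ¬2413 {u} {b} {c} {d} {v} (u<b , b<c , c<d , d≤v , _ , ¬tdm-b , tdm-c , _) =
    distinct-≤⇒< (FinP.<⇒≢ u<v ∘ sym) (ℤP.≮⇒≥ λ Lu<Lv →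
      ¬2413 (u , b , c , v , u<b , b<c , c<v , Lc<Lu , Lu<Lv , ¬TDM⇒>-descendant ¬tdm-b b<v))
    where
    c<v : c Fin.< v
    c<v = ℕP.<-≤-trans c<d d≤v
    b<v : b Fin.< v
    b<v = ℕP.<-trans b<c c<v
    u<v : u Fin.< v
    u<v = ℕP.<-trans u<b b<v
    u<c : u Fin.< c
    u<c = ℕP.<-trans u<b b<c
    Lc<Lu : lookup p c ℤ.< lookup p u
    Lc<Lu = distinct-≤⇒< (FinP.<⇒≢ u<c ∘ sym) (tdm-c u (ℕP.<⇒≤ u<c))

  ¬Occurs2413⇒P1Path : ¬ Occurs2413 p → P1Path p
  ¬Occurs2413⇒P1Path ¬2413 v u _ ceiling with _ , _ , _ , alt ← ceiling⇒Alt4 p ceiling =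
    Alt4⇒end<start ¬2413 alt

  2413⇒Alt4 : ∀ {i j k l m} → i Fin.< j → j Fin.< k → k Fin.< l →
    lookup p k ℤ.< lookup p i → lookup p i ℤ.< lookup p l → lookup p l ℤ.< lookup p j →
    m Fin.≤ i → TDM p m → Alt4 p m j k l l
  2413⇒Alt4 {i} {j} {k} {l} i<j j<k k<l Lk<Li Li<Ll Ll<Lj m≤i tdm-m =
    ℕP.≤-<-trans m≤i i<j , j<k , k<l , ℕP.≤-refl ,
    tdm-m , smaller-ancestor⇒¬TDM p (ℕP.<⇒≤ i<j) (ℤP.<-trans Li<Ll Ll<Lj) , tdm-k , ¬tdm-l
    where
    Lk<Ll : lookup p k ℤ.< lookup p l
    Lk<Ll = ℤP.<-trans Lk<Li Li<Ll
    ¬tdm-l : ¬ TDM p l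
    ¬tdm-l = smaller-ancestor⇒¬TDM p (ℕP.<⇒≤ k<l) Lk<Ll
    tdm-k : TDM p k
    tdm-k with TDM? p k
    ... | yes tdm = tdm
    ... | no ¬tdm = ⊥-elim (ℤP.<-asym Lk<Ll (¬TDM⇒>-descendant ¬tdm k<l))

  P1Path⇒¬Occurs2413 : P1Path p → ¬ Occurs2413 p
  P1Path⇒¬Occurs2413 p1 (i , j , k , l , i<j , j<k , k<l , Lk<Li , Li<Ll , Ll<Lj)
    with m , m≤i , tdm-m , Lm≤Li ← TDM-ancestor p i
    with alt ← 2413⇒Alt4 i<j j<k k<l Lk<Li Li<Ll Ll<Lj m≤i tdm-m
    with u , m≤u , ceiling ← Window⇒∃-ceiling p (Alt4⇒Window p alt)
    with _ , _ , _ , _ , _ , _ , _ , tdm-u , _ ← ceiling⇒Alt4 p ceiling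
    = ℤP.<-asym (p1 l u (Alt4⇒Special p alt) ceiling)
        (ℤP.≤-<-trans (tdm-u m m≤u) (ℤP.≤-<-trans Lm≤Li Li<Ll))

module _ {F : Forest} where

  Occurs123⇒Contains : ∀ {p} → PathF F p → Occurs123 p → Contains F pat123
  Occurs123⇒Contains {p} path (_ , _ , _ , i<j , j<k , Li<Lj , Lj<Lk) =
    p , _ , path , lookup-⊆₃ p i<j j<k , OrderIso-123 Li<Lj Lj<Lk

  Occurs2413⇒Contains : ∀ {p} → PathF F p → Occurs2413 p → Contains F pat2413
  Occurs2413⇒Contains {p} path (_ , _ , _ , _ , i<j , j<k , k<l , Lk<Li , Li<Ll , Ll<Lj) =
    p , _ , path , lookup-⊆₄ p i<j j<k k<l , OrderIso-2413 Lk<Li Li<Ll Ll<Lj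

  Contains⇒Occurs2413 : Contains F pat2413 → ∃[ p ] PathF F p × Occurs2413 p
  Contains⇒Occurs2413 (p , _ ∷ _ ∷ _ ∷ _ ∷ [] , path , sub , iso)
    with i , j , k , l , i<j , j<k , k<l , refl , refl , refl , refl ← ⊆⇒lookup₄ sub
    with Lk<Li , Li<Ll , Ll<Lj ← OrderIso-2413⁻ iso
    = p , path , i , j , k , l , i<j , j<k , k<l , Lk<Li , Li<Ll , Ll<Lj

lemma3p9 : (F : Forest) → DistinctLabels F → Avoids F pat123 →
    (Avoids F pat2413 ⇔ P1Forest F)
lemma3p9 F distinct avoids123 = mk⇔
  (λ avoids2413 p path →
    ¬Occurs2413⇒P1Path (unique path) (¬123 path) (avoids2413 ∘ Occurs2413⇒Contains path))
  (λ p1 contains → let p , path , occurrence = Contains⇒Occurs2413 contains in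
    P1Path⇒¬Occurs2413 (unique path) (¬123 path) (p1 p path) occurrence)
  where
  unique : ∀ {p} → PathF F p → Unique p
  unique = PathF⇒Unique distinct
  ¬123 : ∀ {p} → PathF F p → ¬ Occurs123 p
  ¬123 path = avoids123 ∘ Occurs123⇒Contains path
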